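{- Let $M$ be a $p \times q$ matrix with entries in a field, and let the columns of $M$ be partitioned into $n$ blocks, $M = [M_1, \ldots, M_n]$. The following are equivalent: (1) every $p \times p$ submatrix of $M$ whose columns are taken from pairwise distinct blocks $M_i$ (at most one column from each block) is noninvertible; (2) there exist an invertible $p \times p$ matrix $Q$ and a positive integer $m \leq p$ such that in $QM = [QM_1, \ldots, QM_n]$, the last $m$ rows are identically zero in all but at most $m-1$ of the blocks $QM_i$. -}

module Defs where

open import Level using (Level; _⊔_) renaming (suc to lsuc)
open import Algebra.Bundles using (CommutativeRing)
open import Data.Nat using (ℕ)
open import Data.Fin using (Fin)
open import Data.Sum using (_⊎_)
open import Data.Product using (∃; _×_)
open import Relation.Nullary using (¬_)
open import Relation.Binary.PropositionalEquality using (_≡_)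

-- A field: a commutative ring with 0 ≠ 1 in which every element is zero or
-- has a multiplicative inverse (the usual definition; the disjunction makes
-- "x = 0 or x invertible" available constructively, as in classical algebra).
record Field (c ℓ : Level) : Set (lsuc (c ⊔ ℓ)) where
  field
    commutativeRing : CommutativeRing c ℓ
  open CommutativeRing commutativeRing public
  field
    0≉1 : ¬ (0# ≈ 1#)
    zero-or-invertible : ∀ x → (x ≈ 0#) ⊎ ∃ (λ y → x * y ≈ 1#)

module Matrices {c ℓ} (K : Field c ℓ) where
  open Field K
  open import Algebra.Properties.Monoid.Sum +-monoid using (sum)

  Matrix : ℕ → ℕ → Set c
  Matrix p q = Fin p → Fin q → Carrier

  _≈ᴹ_ : ∀ {p q} → Matrix p q → Matrix p q → Set ℓ
  A ≈ᴹ B = ∀ i j → A i j ≈ B i j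

  _⊗_ : ∀ {p q r} → Matrix p q → Matrix q r → Matrix p r
  (A ⊗ B) i k = sum (λ j → A i j * B j k)

  I : ∀ {p} → Matrix p p
  I i j with i Data.Fin.≟ j
  ... | Relation.Nullary.yes _ = 1#
  ... | Relation.Nullary.no _  = 0#

  Invertible : ∀ {p} → Matrix p p → Set (c ⊔ ℓ)
  Invertible {p} A = ∃ λ (B : Matrix p p) → ((A ⊗ B) ≈ᴹ I) × ((B ⊗ A) ≈ᴹ I)

{-# OPTIONS --safe #-}
-- (2) ⇒ (1): if N is an invertible transversal submatrix, the last m rows of the invertible matrix QN
-- have a right inverse, so they have rank m; but they vanish outside the at most |S| < m columns taken
-- from the blocks in S.
--
-- (1) ⇒ (2): by strong induction on p we show, for every set A of admissible blocks, that there is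
-- either an invertible transversal from distinct blocks of A, or a certificate (Q, m, S) as in (2) for
-- the blocks of A. If all admissible blocks vanish, take m = 1. Otherwise row operations turn some
-- column of an admissible block i₀ into e₀, and we recurse on the last p − 1 rows without i₀. A
-- transversal there extends by that column. A certificate (Q, m, S) there says that, after diag(1, Q),
-- every admissible block outside T = S ∪ {i₀}, |T| ≤ m, vanishes on the last m rows. We then recurse
-- on the first p − m rows with the blocks outside T, and on the last m rows with the blocks of T: two
-- transversals assemble into a block upper triangular invertible matrix, and a certificate for either
-- part lifts to the whole matrix; for the top part, |T| ≤ m pays for adding T to its S and m to its m.
module Submission where

open import Defs
open import Level using (_⊔_)
open import Data.Fin.Base as Fin using (Fin; zero; suc; toℕ; _↑ˡ_; _↑ʳ_; splitAt; join)
import Data.Fin.Properties as Finₚ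
open import Data.Fin.Subset using (Subset; inside; outside; _∈_; _∉_; ∣_∣; ⊤; ⊥; ⁅_⁆; _∪_; _∩_; ∁; _─_)
import Data.Fin.Subset.Properties as Subsetₚ
open import Data.Nat.Induction using (<-rec)
open import Data.Nat.Base as ℕ using (ℕ; zero; suc; _≤_; _<_; _∸_; z≤n; s≤s)
import Data.Nat.Properties as ℕₚ
open import Data.Product.Base using (Σ; ∃; ∃₂; _×_; _,_; proj₁; proj₂)
open import Data.Sum.Base as Sum using (_⊎_; inj₁; inj₂; [_,_]; [_,_]′)
open import Data.Vec.Base using ([]; _∷_)
open import Data.Vec.Functional as Vector using (_++_)
open import Data.Vec.Functional.Properties using (lookup-++ˡ; lookup-++ʳ)
open import Function.Base using (_∘_)
open import Function.Bundles using (_⇔_; mk⇔)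
open import Function.Definitions using (Injective)
open import Relation.Binary.Bundles using (Setoid)
open import Relation.Binary.PropositionalEquality as ≡ using (_≡_; _≢_)
open import Relation.Nullary using (¬_; yes; no; contradiction)
import Relation.Binary.Reasoning.Setoid as SetoidReasoning

toℕ-↑ˡ< : ∀ {d} m (a : Fin d) → toℕ (a ↑ˡ m) < d
toℕ-↑ˡ< m a = ≡.subst (_< _) (≡.sym (Finₚ.toℕ-↑ˡ a m)) (Finₚ.toℕ<n a)

≤-toℕ-↑ʳ : ∀ d {m} (s : Fin m) → d ≤ toℕ (d ↑ʳ s)
≤-toℕ-↑ʳ d s = ≡.subst (d ≤_) (≡.sym (Finₚ.toℕ-↑ʳ d s)) (ℕₚ.m≤m+n d (toℕ s))

↑ˡ≢↑ʳ : ∀ {d m} (a : Fin d) (s : Fin m) → a ↑ˡ m ≢ d ↑ʳ s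
↑ˡ≢↑ʳ {d} {m} a s eq = ℕₚ.<⇒≱ (toℕ-↑ˡ< m a) (≡.subst (λ i → d ≤ toℕ i) (≡.sym eq) (≤-toℕ-↑ʳ d s))

↑-elim : ∀ {ℓ′} d {m} {P : Fin (d ℕ.+ m) → Set ℓ′} →
         (∀ a → P (a ↑ˡ m)) → (∀ s → P (d ↑ʳ s)) → ∀ i → P i
↑-elim d {m} {P} top bottom i =
  ≡.subst P (Finₚ.join-splitAt d m i) ([_,_] {C = P ∘ join d m} top bottom (splitAt d i))

∀⊎∃ : ∀ {a b k} {P : Fin k → Set a} {Q : Fin k → Set b} → (∀ i → P i ⊎ Q i) → (∀ i → P i) ⊎ ∃ Q
∀⊎∃ {k = zero}  P⊎Q = inj₁ λ ()
∀⊎∃ {k = suc k} P⊎Q with P⊎Q zero | ∀⊎∃ (P⊎Q ∘ suc)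
... | inj₂ q₀ | _              = inj₂ (zero , q₀)
... | inj₁ _  | inj₂ (i , qᵢ)  = inj₂ (suc i , qᵢ)
... | inj₁ p₀ | inj₁ p         = inj₁ λ { zero → p₀ ; (suc i) → p i }

lastRows : ∀ {m p} → m ≤ p → Fin m → Fin p
lastRows {m} {p} m≤p s = Fin.cast (ℕₚ.m∸n+n≡m m≤p) ((p ∸ m) ↑ʳ s)

toℕ-lastRows : ∀ {m p} (m≤p : m ≤ p) (s : Fin m) → toℕ (lastRows m≤p s) ≡ p ∸ m ℕ.+ toℕ s
toℕ-lastRows {m} {p} m≤p s = ≡.trans (Finₚ.toℕ-cast _ ((p ∸ m) ↑ʳ s)) (Finₚ.toℕ-↑ʳ (p ∸ m) s)

lastRows-injective : ∀ {m p} (m≤p : m ≤ p) → Injective _≡_ _≡_ (lastRows m≤p)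
lastRows-injective {m} {p} m≤p {s} {t} eq = Finₚ.toℕ-injective (ℕₚ.+-cancelˡ-≡ (p ∸ m) _ _
  (≡.trans (≡.sym (toℕ-lastRows m≤p s)) (≡.trans (≡.cong toℕ eq) (toℕ-lastRows m≤p t))))

∣p∪q∣≤∣p∣+∣q∣ : ∀ {n} (p q : Subset n) → ∣ p ∪ q ∣ ≤ ∣ p ∣ ℕ.+ ∣ q ∣
∣p∪q∣≤∣p∣+∣q∣ []            []            = z≤n
∣p∪q∣≤∣p∣+∣q∣ (outside ∷ p) (outside ∷ q) = ∣p∪q∣≤∣p∣+∣q∣ p q
∣p∪q∣≤∣p∣+∣q∣ (outside ∷ p) (inside  ∷ q) =
  ℕₚ.≤-trans (s≤s (∣p∪q∣≤∣p∣+∣q∣ p q)) (ℕₚ.≤-reflexive (≡.sym (ℕₚ.+-suc ∣ p ∣ ∣ q ∣)))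
∣p∪q∣≤∣p∣+∣q∣ (inside  ∷ p) (outside ∷ q) = s≤s (∣p∪q∣≤∣p∣+∣q∣ p q)
∣p∪q∣≤∣p∣+∣q∣ (inside  ∷ p) (inside  ∷ q) =
  s≤s (ℕₚ.≤-trans (∣p∪q∣≤∣p∣+∣q∣ p q) (ℕₚ.+-monoʳ-≤ ∣ p ∣ (ℕₚ.n≤1+n ∣ q ∣)))

splitAt-injective : ∀ d {m} {i j : Fin (d ℕ.+ m)} → splitAt d i ≡ splitAt d j → i ≡ j
splitAt-injective d {m} {i} {j} eq =
  ≡.trans (≡.sym (Finₚ.join-splitAt d m i)) (≡.trans (≡.cong (join d m) eq) (Finₚ.join-splitAt d m j))

∘-++-injective : ∀ {a b d m} {A : Set a} {B : Set b} (h : A → B) {f : Fin d → A} {g : Fin m → A} →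
               Injective _≡_ _≡_ (h ∘ f) → Injective _≡_ _≡_ (h ∘ g) → (∀ a s → h (f a) ≢ h (g s)) →
               Injective _≡_ _≡_ (h ∘ (f ++ g))
∘-++-injective {d = d} h {f} {g} hf-inj hg-inj disjoint {i} {j} eq =
  splitAt-injective d (onSplit (splitAt d i) (splitAt d j) eq)
  where
  onSplit : ∀ u v → h ([ f , g ] u) ≡ h ([ f , g ] v) → u ≡ v
  onSplit (inj₁ a) (inj₁ b) e = ≡.cong inj₁ (hf-inj e)
  onSplit (inj₁ a) (inj₂ t) e = contradiction e (disjoint a t)
  onSplit (inj₂ s) (inj₁ b) e = contradiction (≡.sym e) (disjoint b s)
  onSplit (inj₂ s) (inj₂ t) e = ≡.cong inj₂ (hg-inj e)

module _ {c ℓ} (K : Field c ℓ) where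
  open Field K hiding (zero)
  open Matrices K
  open import Algebra.Definitions _≈_ using (RightInvertible)
  open import Algebra.Properties.Semiring.Sum semiring
    using (sum; sum-cong-≋; sum-replicate-zero; ∑-distrib-+; ∑-comm; *-distribˡ-sum; *-distribʳ-sum)
  open import Algebra.Properties.Ring ring using (-‿distribˡ-*; -‿distribʳ-*)
  open import Algebra.Properties.Group +-group using (inverseʳ-unique)

  -- Matrices over K

  sum-≈0 : ∀ {k} {f : Fin k → Carrier} → (∀ i → f i ≈ 0#) → sum f ≈ 0#
  sum-≈0 {k} f≈0 = trans (sum-cong-≋ f≈0) (sum-replicate-zero k)

  sum-split : ∀ d {m} (f : Fin (d ℕ.+ m) → Carrier) →
              sum f ≈ sum (f ∘ (_↑ˡ m)) + sum (f ∘ (d ↑ʳ_))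
  sum-split zero    f = sym (+-identityˡ _)
  sum-split (suc d) f = trans (+-congˡ (sum-split d (f ∘ suc))) (sym (+-assoc _ _ _))

  sum-neg : ∀ {k} (f : Fin k → Carrier) → sum (λ i → - f i) ≈ - sum f
  sum-neg f = inverseʳ-unique (sum f) _ (begin
    sum f + sum (λ i → - f i)  ≈⟨ ∑-distrib-+ f _ ⟨
    sum (λ i → f i - f i)      ≈⟨ sum-≈0 (λ i → -‿inverseʳ (f i)) ⟩
    0#                         ∎)
    where open SetoidReasoning setoid

  I-diagonal : ∀ {p} (i : Fin p) → I i i ≈ 1#
  I-diagonal i with i Finₚ.≟ i
  ... | yes _   = refl
  ... | no i≢i = contradiction ≡.refl i≢i

  I-offDiagonal : ∀ {p} {i j : Fin p} → i ≢ j → I i j ≈ 0#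
  I-offDiagonal {i = i} {j} i≢j with i Finₚ.≟ j
  ... | yes i≡j = contradiction i≡j i≢j
  ... | no _    = refl

  I-reindex : ∀ {p q} {f : Fin p → Fin q} → Injective _≡_ _≡_ f → ∀ a b → I (f a) (f b) ≈ I a b
  I-reindex {f = f} f-inj a b with a Finₚ.≟ b
  ... | yes ≡.refl = I-diagonal (f a)
  ... | no a≢b   = I-offDiagonal (a≢b ∘ f-inj)

  I-sym : ∀ {p} (i j : Fin p) → I i j ≈ I j i
  I-sym i j with i Finₚ.≟ j
  ... | yes ≡.refl = sym (I-diagonal i)
  ... | no i≢j   = sym (I-offDiagonal (i≢j ∘ ≡.sym))

  sum-I-* : ∀ {p} (i : Fin p) (x : Fin p → Carrier) → sum (λ j → I i j * x j) ≈ x i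
  sum-I-* {suc p} zero x = begin
    1# * x zero + sum (λ j → 0# * x (suc j))
      ≈⟨ +-cong (*-identityˡ _) (sum-≈0 {p} (λ j → zeroˡ (x (suc j)))) ⟩
    x zero + 0#                                ≈⟨ +-identityʳ _ ⟩
    x zero                                     ∎
    where open SetoidReasoning setoid
  sum-I-* {suc p} (suc i) x = begin
    0# * x zero + sum (λ j → I (suc i) (suc j) * x (suc j))
      ≈⟨ +-cong (zeroˡ _) (sum-cong-≋ (λ j → *-congʳ (I-reindex Finₚ.suc-injective i j))) ⟩
    0# + sum (λ j → I i j * x (suc j))  ≈⟨ +-identityˡ _ ⟩
    sum (λ j → I i j * x (suc j))       ≈⟨ sum-I-* i (x ∘ suc) ⟩
    x (suc i)                           ∎
    where open SetoidReasoning setoid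

  sum-*-I : ∀ {p} (i : Fin p) (x : Fin p → Carrier) → sum (λ j → x j * I j i) ≈ x i
  sum-*-I i x = trans (sum-cong-≋ (λ j → trans (*-comm _ _) (*-congʳ (I-sym j i)))) (sum-I-* i x)

  0ᴹ : ∀ {p q} → Matrix p q
  0ᴹ _ _ = 0#

  -ᴹ_ : ∀ {p q} → Matrix p q → Matrix p q
  (-ᴹ A) i j = - A i j

  _+ᴹ_ : ∀ {p q} → Matrix p q → Matrix p q → Matrix p q
  (A +ᴹ B) i j = A i j + B i j

  _ᵀ : ∀ {p q} → Matrix p q → Matrix q p
  (A ᵀ) i j = A j i

  ≈ᴹ-setoid : ℕ → ℕ → Setoid c ℓ
  ≈ᴹ-setoid p q = record
    { Carrier       = Matrix p q
    ; _≈_           = _≈ᴹ_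
    ; isEquivalence = record
      { refl  = λ _ _ → refl
      ; sym   = λ A≈B i j → sym (A≈B i j)
      ; trans = λ A≈B B≈C i j → trans (A≈B i j) (B≈C i j)
      }
    }

  module ≈ᴹ {p q} = Setoid (≈ᴹ-setoid p q)

  ⊗-cong : ∀ {p q r} {A A′ : Matrix p q} {B B′ : Matrix q r} →
           A ≈ᴹ A′ → B ≈ᴹ B′ → (A ⊗ B) ≈ᴹ (A′ ⊗ B′)
  ⊗-cong A≈A′ B≈B′ i k = sum-cong-≋ (λ j → *-cong (A≈A′ i j) (B≈B′ j k))

  ⊗-congˡ : ∀ {p q r} (A : Matrix p q) {B B′ : Matrix q r} → B ≈ᴹ B′ → (A ⊗ B) ≈ᴹ (A ⊗ B′)
  ⊗-congˡ A = ⊗-cong (≈ᴹ.refl {x = A})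

  ⊗-congʳ : ∀ {p q r} {A A′ : Matrix p q} (B : Matrix q r) → A ≈ᴹ A′ → (A ⊗ B) ≈ᴹ (A′ ⊗ B)
  ⊗-congʳ B A≈A′ = ⊗-cong A≈A′ (≈ᴹ.refl {x = B})

  ⊗-assoc : ∀ {p q r s} (A : Matrix p q) (B : Matrix q r) (C : Matrix r s) →
            ((A ⊗ B) ⊗ C) ≈ᴹ (A ⊗ (B ⊗ C))
  ⊗-assoc {q = q} {r} A B C i l = begin
    sum (λ k → sum (λ j → A i j * B j k) * C k l)
      ≈⟨ sum-cong-≋ {r} (λ k → *-distribʳ-sum (C k l) (λ j → A i j * B j k)) ⟩
    sum (λ k → sum (λ j → A i j * B j k * C k l))
      ≈⟨ ∑-comm {r} {q} (λ k j → A i j * B j k * C k l) ⟩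
    sum (λ j → sum (λ k → A i j * B j k * C k l))
      ≈⟨ sum-cong-≋ {q} (λ j → sum-cong-≋ {r} (λ k → *-assoc _ _ _)) ⟩
    sum (λ j → sum (λ k → A i j * (B j k * C k l)))
      ≈⟨ sum-cong-≋ {q} (λ j → *-distribˡ-sum (A i j) (λ k → B j k * C k l)) ⟨
    sum (λ j → A i j * sum (λ k → B j k * C k l))
      ∎
    where open SetoidReasoning setoid

  ⊗-identityˡ : ∀ {p q} (A : Matrix p q) → (I ⊗ A) ≈ᴹ A
  ⊗-identityˡ A i k = sum-I-* i (λ j → A j k)

  ⊗-identityʳ : ∀ {p q} (A : Matrix p q) → (A ⊗ I) ≈ᴹ A
  ⊗-identityʳ A i k = sum-*-I k (A i)

  ⊗-zeroˡ : ∀ {p q r} (A : Matrix q r) → (0ᴹ {p} ⊗ A) ≈ᴹ 0ᴹ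
  ⊗-zeroˡ A i k = sum-≈0 (λ j → zeroˡ (A j k))

  ⊗-zeroColumn : ∀ {p q r} (A : Matrix p q) {B : Matrix q r} {k} →
                 (∀ j → B j k ≈ 0#) → ∀ i → (A ⊗ B) i k ≈ 0#
  ⊗-zeroColumn A Bk≈0 i = sum-≈0 (λ j → trans (*-congˡ (Bk≈0 j)) (zeroʳ (A i j)))

  ⊗-zeroʳ : ∀ {p q r} (A : Matrix p q) → (A ⊗ 0ᴹ {q} {r}) ≈ᴹ 0ᴹ
  ⊗-zeroʳ {q = q} {r} A i k = ⊗-zeroColumn A {0ᴹ {q} {r}} {k} (λ _ → refl) i

  -ᴹ-cong : ∀ {p q} {A B : Matrix p q} → A ≈ᴹ B → (-ᴹ A) ≈ᴹ (-ᴹ B)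
  -ᴹ-cong A≈B i j = -‿cong (A≈B i j)

  ⊗-negˡ : ∀ {p q r} (A : Matrix p q) (B : Matrix q r) → ((-ᴹ A) ⊗ B) ≈ᴹ (-ᴹ (A ⊗ B))
  ⊗-negˡ {q = q} A B i k =
    trans (sum-cong-≋ {q} (λ j → sym (-‿distribˡ-* (A i j) (B j k)))) (sum-neg (λ j → A i j * B j k))

  ⊗-negʳ : ∀ {p q r} (A : Matrix p q) (B : Matrix q r) → (A ⊗ (-ᴹ B)) ≈ᴹ (-ᴹ (A ⊗ B))
  ⊗-negʳ {q = q} A B i k =
    trans (sum-cong-≋ {q} (λ j → sym (-‿distribʳ-* (A i j) (B j k)))) (sum-neg (λ j → A i j * B j k))

  ⊗-rightInverse : ∀ {p q r} {A : Matrix p q} {A′ : Matrix q p} {B : Matrix q r} {B′ : Matrix r q} →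
                   (A ⊗ A′) ≈ᴹ I → (B ⊗ B′) ≈ᴹ I → ((A ⊗ B) ⊗ (B′ ⊗ A′)) ≈ᴹ I
  ⊗-rightInverse {A = A} {A′} {B} {B′} AA′≈I BB′≈I = begin
    (A ⊗ B) ⊗ (B′ ⊗ A′)  ≈⟨ ⊗-assoc A B _ ⟩
    A ⊗ (B ⊗ (B′ ⊗ A′))  ≈⟨ ⊗-congˡ A (⊗-assoc B B′ A′) ⟨
    A ⊗ ((B ⊗ B′) ⊗ A′)  ≈⟨ ⊗-congˡ A (⊗-congʳ A′ BB′≈I) ⟩
    A ⊗ (I ⊗ A′)         ≈⟨ ⊗-congˡ A (⊗-identityˡ A′) ⟩
    A ⊗ A′               ≈⟨ AA′≈I ⟩
    I                    ∎
    where open SetoidReasoning (≈ᴹ-setoid _ _)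

  ᵀ-rightInverse : ∀ {p} {A A′ : Matrix p p} → (A′ ⊗ A) ≈ᴹ I → ((A ᵀ) ⊗ (A′ ᵀ)) ≈ᴹ I
  ᵀ-rightInverse {p} A′A≈I i j =
    trans (sum-cong-≋ {p} (λ k → *-comm _ _)) (trans (A′A≈I j i) (I-sym j i))

  Invertible-resp : ∀ {p} {A B : Matrix p p} → A ≈ᴹ B → Invertible A → Invertible B
  Invertible-resp A≈B (A⁻¹ , AA⁻¹≈I , A⁻¹A≈I) =
    A⁻¹ , ≈ᴹ.trans (⊗-congʳ A⁻¹ (≈ᴹ.sym A≈B)) AA⁻¹≈I , ≈ᴹ.trans (⊗-congˡ A⁻¹ (≈ᴹ.sym A≈B)) A⁻¹A≈I

  Invertible-I : ∀ {p} → Invertible (I {p})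
  Invertible-I = I , ⊗-identityʳ I , ⊗-identityʳ I

  Invertible-⊗ : ∀ {p} {A B : Matrix p p} → Invertible A → Invertible B → Invertible (A ⊗ B)
  Invertible-⊗ {A = A} {B} (A⁻¹ , AA⁻¹≈I , A⁻¹A≈I) (B⁻¹ , BB⁻¹≈I , B⁻¹B≈I) =
    (B⁻¹ ⊗ A⁻¹) ,
    ⊗-rightInverse {A = A} {A⁻¹} {B} {B⁻¹} AA⁻¹≈I BB⁻¹≈I ,
    ⊗-rightInverse {A = B⁻¹} {B} {A⁻¹} {A} B⁻¹B≈I A⁻¹A≈I

  Invertible-cancelˡ : ∀ {p} {Q N : Matrix p p} → Invertible Q → Invertible (Q ⊗ N) → Invertible N
  Invertible-cancelˡ {Q = Q} {N} (Q⁻¹ , QQ⁻¹≈I , Q⁻¹Q≈I) QN-inv =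
    Invertible-resp Q⁻¹QN≈N (Invertible-⊗ (Q , Q⁻¹Q≈I , QQ⁻¹≈I) QN-inv)
    where
    Q⁻¹QN≈N : (Q⁻¹ ⊗ (Q ⊗ N)) ≈ᴹ N
    Q⁻¹QN≈N = ≈ᴹ.trans (≈ᴹ.sym (⊗-assoc Q⁻¹ Q N)) (≈ᴹ.trans (⊗-congʳ N Q⁻¹Q≈I) (⊗-identityˡ N))

  Invertible-ᵀ : ∀ {p} {A : Matrix p p} → Invertible A → Invertible (A ᵀ)
  Invertible-ᵀ (A⁻¹ , AA⁻¹≈I , A⁻¹A≈I) = (A⁻¹ ᵀ) , ᵀ-rightInverse A⁻¹A≈I , ᵀ-rightInverse AA⁻¹≈I

  scalar : Carrier → Matrix 1 1
  scalar x _ _ = x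

  Invertible-scalar : ∀ {x} → RightInvertible 1# _*_ x → Invertible (scalar x)
  Invertible-scalar {x} (y , xy≈1) = scalar y , xy≈I , yx≈I
    where
    xy≈I : (scalar x ⊗ scalar y) ≈ᴹ I
    xy≈I zero zero = trans (+-identityʳ _) xy≈1
    yx≈I : (scalar y ⊗ scalar x) ≈ᴹ I
    yx≈I zero zero = trans (+-identityʳ _) (trans (*-comm y x) xy≈1)

  -- Block matrices

  topRows : ∀ {d m q} → Matrix (d ℕ.+ m) q → Matrix d q
  topRows {m = m} X a = X (a ↑ˡ m)

  bottomRows : ∀ {d m q} → Matrix (d ℕ.+ m) q → Matrix m q
  bottomRows {d} X s = X (d ↑ʳ s)

  leftCols : ∀ {p d m} → Matrix p (d ℕ.+ m) → Matrix p d
  leftCols {m = m} X i a = X i (a ↑ˡ m)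

  rightCols : ∀ {p d m} → Matrix p (d ℕ.+ m) → Matrix p m
  rightCols {d = d} X i s = X i (d ↑ʳ s)

  ⊗-split : ∀ {p d m q} (X : Matrix p (d ℕ.+ m)) (Y : Matrix (d ℕ.+ m) q) →
            (X ⊗ Y) ≈ᴹ ((leftCols {d = d} X ⊗ topRows Y) +ᴹ (rightCols {d = d} X ⊗ bottomRows Y))
  ⊗-split {d = d} {m} X Y i k = sum-split d {m} (λ j → X i j * Y j k)

  module _ {d₁ m₁ d₂ m₂ : ℕ} where

    blk : Matrix d₁ d₂ → Matrix d₁ m₂ → Matrix m₁ d₂ → Matrix m₁ m₂ → Matrix (d₁ ℕ.+ m₁) (d₂ ℕ.+ m₂)
    blk A B C D = (λ a → A a ++ B a) ++ (λ s → C s ++ D s)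

    module _ (A : Matrix d₁ d₂) (B : Matrix d₁ m₂) (C : Matrix m₁ d₂) (D : Matrix m₁ m₂) where
      private
        top : Matrix d₁ (d₂ ℕ.+ m₂)
        top a = A a ++ B a
        bottom : Matrix m₁ (d₂ ℕ.+ m₂)
        bottom s = C s ++ D s

      blk-topLeft : ∀ a b → blk A B C D (a ↑ˡ m₁) (b ↑ˡ m₂) ≈ A a b
      blk-topLeft a b =
        reflexive (≡.trans (≡.cong-app (lookup-++ˡ top bottom a) (b ↑ˡ m₂)) (lookup-++ˡ (A a) (B a) b))

      blk-topRight : ∀ a t → blk A B C D (a ↑ˡ m₁) (d₂ ↑ʳ t) ≈ B a t
      blk-topRight a t =
        reflexive (≡.trans (≡.cong-app (lookup-++ˡ top bottom a) (d₂ ↑ʳ t)) (lookup-++ʳ (A a) (B a) t))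

      blk-bottomLeft : ∀ s b → blk A B C D (d₁ ↑ʳ s) (b ↑ˡ m₂) ≈ C s b
      blk-bottomLeft s b =
        reflexive (≡.trans (≡.cong-app (lookup-++ʳ top bottom s) (b ↑ˡ m₂)) (lookup-++ˡ (C s) (D s) b))

      blk-bottomRight : ∀ s t → blk A B C D (d₁ ↑ʳ s) (d₂ ↑ʳ t) ≈ D s t
      blk-bottomRight s t =
        reflexive (≡.trans (≡.cong-app (lookup-++ʳ top bottom s) (d₂ ↑ʳ t)) (lookup-++ʳ (C s) (D s) t))

      ≈ᴹ-blk : {X : Matrix (d₁ ℕ.+ m₁) (d₂ ℕ.+ m₂)} →
               (∀ a b → X (a ↑ˡ m₁) (b ↑ˡ m₂) ≈ A a b) → (∀ a t → X (a ↑ˡ m₁) (d₂ ↑ʳ t) ≈ B a t) →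
               (∀ s b → X (d₁ ↑ʳ s) (b ↑ˡ m₂) ≈ C s b) → (∀ s t → X (d₁ ↑ʳ s) (d₂ ↑ʳ t) ≈ D s t) →
               X ≈ᴹ blk A B C D
      ≈ᴹ-blk {X} X≈A X≈B X≈C X≈D = ↑-elim d₁ {P = λ i → ∀ j → X i j ≈ blk A B C D i j}
        (λ a → ↑-elim d₂ (λ b → trans (X≈A a b) (sym (blk-topLeft a b)))
                         (λ t → trans (X≈B a t) (sym (blk-topRight a t))))
        (λ s → ↑-elim d₂ (λ b → trans (X≈C s b) (sym (blk-bottomLeft s b)))
                         (λ t → trans (X≈D s t) (sym (blk-bottomRight s t))))

  diag : ∀ {d m} → Matrix d d → Matrix m m → Matrix (d ℕ.+ m) (d ℕ.+ m)
  diag A D = blk A 0ᴹ 0ᴹ D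

  I≈diag : ∀ {d m} → I {d ℕ.+ m} ≈ᴹ diag {d} {m} I I
  I≈diag {d} {m} = ≈ᴹ-blk I 0ᴹ 0ᴹ I
    (I-reindex (Finₚ.↑ˡ-injective m _ _))
    (λ a t → I-offDiagonal (↑ˡ≢↑ʳ a t))
    (λ s b → I-offDiagonal (↑ˡ≢↑ʳ b s ∘ ≡.sym))
    (I-reindex (Finₚ.↑ʳ-injective d _ _))

  module _ {d₁ m₁ d₂ m₂ d₃ m₃ : ℕ}
           {A : Matrix d₁ d₂} {B : Matrix d₁ m₂} {C : Matrix m₁ d₂} {D : Matrix m₁ m₂}
           {E : Matrix d₂ d₃} {F : Matrix d₂ m₃} {G : Matrix m₂ d₃} {H : Matrix m₂ m₃}
           {W : Matrix d₁ d₃} {X : Matrix d₁ m₃} {Y : Matrix m₁ d₃} {Z : Matrix m₁ m₃} where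

    blk-⊗ : ((A ⊗ E) +ᴹ (B ⊗ G)) ≈ᴹ W → ((A ⊗ F) +ᴹ (B ⊗ H)) ≈ᴹ X →
            ((C ⊗ E) +ᴹ (D ⊗ G)) ≈ᴹ Y → ((C ⊗ F) +ᴹ (D ⊗ H)) ≈ᴹ Z →
            (blk A B C D ⊗ blk E F G H) ≈ᴹ blk W X Y Z
    blk-⊗ ≈W ≈X ≈Y ≈Z = ≈ᴹ-blk W X Y Z
      (λ a b → trans (⊗-split {d = d₂} {m₂} L R (a ↑ˡ m₁) (b ↑ˡ m₃)) (trans (+-cong
        (⊗-cong (blk-topLeft A B C D) (blk-topLeft E F G H) a b)
        (⊗-cong (blk-topRight A B C D) (blk-bottomLeft E F G H) a b)) (≈W a b)))
      (λ a t → trans (⊗-split {d = d₂} {m₂} L R (a ↑ˡ m₁) (d₃ ↑ʳ t)) (trans (+-cong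
        (⊗-cong (blk-topLeft A B C D) (blk-topRight E F G H) a t)
        (⊗-cong (blk-topRight A B C D) (blk-bottomRight E F G H) a t)) (≈X a t)))
      (λ s b → trans (⊗-split {d = d₂} {m₂} L R (d₁ ↑ʳ s) (b ↑ˡ m₃)) (trans (+-cong
        (⊗-cong (blk-bottomLeft A B C D) (blk-topLeft E F G H) s b)
        (⊗-cong (blk-bottomRight A B C D) (blk-bottomLeft E F G H) s b)) (≈Y s b)))
      (λ s t → trans (⊗-split {d = d₂} {m₂} L R (d₁ ↑ʳ s) (d₃ ↑ʳ t)) (trans (+-cong
        (⊗-cong (blk-bottomLeft A B C D) (blk-topRight E F G H) s t)
        (⊗-cong (blk-bottomRight A B C D) (blk-bottomRight E F G H) s t)) (≈Z s t)))
      where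
      L = blk A B C D
      R = blk E F G H

  Invertible-blkUpper : ∀ {d m} {A : Matrix d d} {C : Matrix m m} (B : Matrix d m) →
                        Invertible A → Invertible C → Invertible (blk A B 0ᴹ C)
  Invertible-blkUpper {d} {m} {A} {C} B (A⁻¹ , AA⁻¹≈I , A⁻¹A≈I) (C⁻¹ , CC⁻¹≈I , C⁻¹C≈I) =
    blk A⁻¹ B′ 0ᴹ C⁻¹ ,
    ≈ᴹ.trans (blk-⊗ {A = A} {B} {0ᴹ} {C} (+⊗0 B AA⁻¹≈I) AB′+BC⁻¹≈0 (0⊗+⊗0 A⁻¹ C) (0⊗+ B′ CC⁻¹≈I))
             (≈ᴹ.sym (I≈diag {d} {m})) ,
    ≈ᴹ.trans (blk-⊗ {A = A⁻¹} {B′} {0ᴹ} {C⁻¹} (+⊗0 B′ A⁻¹A≈I) A⁻¹B+B′C≈0 (0⊗+⊗0 A C⁻¹) (0⊗+ B C⁻¹C≈I))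
             (≈ᴹ.sym (I≈diag {d} {m}))
    where
    open SetoidReasoning (≈ᴹ-setoid _ _)
    B′ : Matrix d m
    B′ = -ᴹ (A⁻¹ ⊗ (B ⊗ C⁻¹))

    +⊗0 : ∀ {p q r} {P P′ : Matrix p r} (U : Matrix p q) → P ≈ᴹ P′ → (P +ᴹ (U ⊗ 0ᴹ)) ≈ᴹ P′
    +⊗0 U P≈P′ i k = trans (+-cong (P≈P′ i k) (⊗-zeroʳ U i k)) (+-identityʳ _)

    0⊗+ : ∀ {p q r} {P P′ : Matrix p r} (U : Matrix q r) → P ≈ᴹ P′ → ((0ᴹ ⊗ U) +ᴹ P) ≈ᴹ P′
    0⊗+ U P≈P′ i k = trans (+-cong (⊗-zeroˡ U i k) (P≈P′ i k)) (+-identityˡ _)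

    0⊗+⊗0 : ∀ {p q r s} (U : Matrix q r) (V : Matrix p s) → ((0ᴹ ⊗ U) +ᴹ (V ⊗ 0ᴹ)) ≈ᴹ 0ᴹ
    0⊗+⊗0 U V = 0⊗+ U (⊗-zeroʳ V)

    AB′+BC⁻¹≈0 : ((A ⊗ B′) +ᴹ (B ⊗ C⁻¹)) ≈ᴹ 0ᴹ
    AB′+BC⁻¹≈0 i k = trans (+-congʳ (AB′≈-BC⁻¹ i k)) (-‿inverseˡ _)
      where
      AB′≈-BC⁻¹ : (A ⊗ B′) ≈ᴹ (-ᴹ (B ⊗ C⁻¹))
      AB′≈-BC⁻¹ = begin
        A ⊗ B′                         ≈⟨ ⊗-negʳ A _ ⟩
        -ᴹ (A ⊗ (A⁻¹ ⊗ (B ⊗ C⁻¹)))    ≈⟨ -ᴹ-cong (⊗-assoc A A⁻¹ _) ⟨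
        -ᴹ ((A ⊗ A⁻¹) ⊗ (B ⊗ C⁻¹))    ≈⟨ -ᴹ-cong (⊗-congʳ (B ⊗ C⁻¹) AA⁻¹≈I) ⟩
        -ᴹ (I ⊗ (B ⊗ C⁻¹))            ≈⟨ -ᴹ-cong (⊗-identityˡ _) ⟩
        -ᴹ (B ⊗ C⁻¹)                  ∎

    A⁻¹B+B′C≈0 : ((A⁻¹ ⊗ B) +ᴹ (B′ ⊗ C)) ≈ᴹ 0ᴹ
    A⁻¹B+B′C≈0 i k = trans (+-congˡ (B′C≈-A⁻¹B i k)) (-‿inverseʳ _)
      where
      B′C≈-A⁻¹B : (B′ ⊗ C) ≈ᴹ (-ᴹ (A⁻¹ ⊗ B))
      B′C≈-A⁻¹B = begin
        B′ ⊗ C                          ≈⟨ ⊗-negˡ _ C ⟩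
        -ᴹ ((A⁻¹ ⊗ (B ⊗ C⁻¹)) ⊗ C)     ≈⟨ -ᴹ-cong (⊗-assoc A⁻¹ _ C) ⟩
        -ᴹ (A⁻¹ ⊗ ((B ⊗ C⁻¹) ⊗ C))     ≈⟨ -ᴹ-cong (⊗-congˡ A⁻¹ (⊗-assoc B C⁻¹ C)) ⟩
        -ᴹ (A⁻¹ ⊗ (B ⊗ (C⁻¹ ⊗ C)))     ≈⟨ -ᴹ-cong (⊗-congˡ A⁻¹ (⊗-congˡ B C⁻¹C≈I)) ⟩
        -ᴹ (A⁻¹ ⊗ (B ⊗ I))             ≈⟨ -ᴹ-cong (⊗-congˡ A⁻¹ (⊗-identityʳ B)) ⟩
        -ᴹ (A⁻¹ ⊗ B)                   ∎

  Invertible-diag : ∀ {d m} {A : Matrix d d} {D : Matrix m m} →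
                    Invertible A → Invertible D → Invertible (diag A D)
  Invertible-diag = Invertible-blkUpper 0ᴹ

  topRows-diag-⊗ : ∀ {d m q} (A : Matrix d d) (D : Matrix m m) (X : Matrix (d ℕ.+ m) q) →
                   topRows (diag A D ⊗ X) ≈ᴹ (A ⊗ topRows X)
  topRows-diag-⊗ {d} {m} A D X a k = trans (⊗-split {d = d} {m} (diag A D) X (a ↑ˡ m) k) (trans (+-cong
    (⊗-congʳ (topRows {d} X) (blk-topLeft A 0ᴹ 0ᴹ D) a k)
    (trans (⊗-congʳ (bottomRows {d} X) (blk-topRight A 0ᴹ 0ᴹ D) a k) (⊗-zeroˡ (bottomRows {d} X) a k)))
    (+-identityʳ _))

  bottomRows-diag-⊗ : ∀ {d m q} (A : Matrix d d) (D : Matrix m m) (X : Matrix (d ℕ.+ m) q) →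
                      bottomRows (diag A D ⊗ X) ≈ᴹ (D ⊗ bottomRows X)
  bottomRows-diag-⊗ {d} {m} A D X s k = trans (⊗-split {d = d} {m} (diag A D) X (d ↑ʳ s) k) (trans (+-cong
    (trans (⊗-congʳ (topRows {d} X) (blk-bottomLeft A 0ᴹ 0ᴹ D) s k) (⊗-zeroˡ (topRows {d} X) s k))
    (⊗-congʳ (bottomRows {d} X) (blk-bottomRight A 0ᴹ 0ᴹ D) s k))
    (+-identityˡ _))

  -- Pivoting and the rank bound

  RightInvertible-resp : ∀ {x y} → x ≈ y → RightInvertible 1# _*_ x → RightInvertible 1# _*_ y
  RightInvertible-resp x≈y (z , xz≈1) = z , trans (*-congʳ (sym x≈y)) xz≈1

  0-notRightInvertible : ∀ {x} → x ≈ 0# → ¬ RightInvertible 1# _*_ x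
  0-notRightInvertible x≈0 (y , xy≈1) = 0≉1 (trans (sym (zeroˡ y)) (trans (*-congʳ (sym x≈0)) xy≈1))

  zero-or-unitEntry : ∀ {p q} (X : Matrix p q) → X ≈ᴹ 0ᴹ ⊎ ∃₂ λ r j → RightInvertible 1# _*_ (X r j)
  zero-or-unitEntry X = ∀⊎∃ λ r → ∀⊎∃ λ j → zero-or-invertible (X r j)

  record Pivot {p q} (X : Matrix (suc p) q) (j : Fin q) : Set (c ⊔ ℓ) where
    field
      Q          : Matrix (suc p) (suc p)
      invertible : Invertible Q
      column     : ∀ r → (Q ⊗ X) r j ≈ I r zero

  pivotAtTop : ∀ {p q} (X : Matrix (suc p) q) (j : Fin q) → RightInvertible 1# _*_ (X zero j) → Pivot X j
  pivotAtTop {p} X j X₀ⱼ-invertible = record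
    { Q          = P⁻¹
    ; invertible = P , P⁻¹P≈I , PP⁻¹≈I
    ; column     = column
    }
    where
    below : Matrix 1 p
    below _ k = X (suc k) j

    -- P is I with its first column replaced by column j of X, so P⁻¹ sends that column to e₀.
    T : Matrix (suc p) (suc p)
    T = blk (scalar (X zero j)) below 0ᴹ I

    P : Matrix (suc p) (suc p)
    P = T ᵀ

    P-invertible : Invertible P
    P-invertible =
      Invertible-ᵀ {A = T} (Invertible-blkUpper below (Invertible-scalar X₀ⱼ-invertible) Invertible-I)

    P⁻¹ : Matrix (suc p) (suc p)
    P⁻¹ = proj₁ P-invertible
    PP⁻¹≈I : (P ⊗ P⁻¹) ≈ᴹ I
    PP⁻¹≈I = proj₁ (proj₂ P-invertible)
    P⁻¹P≈I : (P⁻¹ ⊗ P) ≈ᴹ I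
    P⁻¹P≈I = proj₂ (proj₂ P-invertible)

    P-column : ∀ k → X k j ≈ P k zero
    P-column zero    = refl
    P-column (suc k) = refl

    column : ∀ r → (P⁻¹ ⊗ X) r j ≈ I r zero
    column r = trans (sum-cong-≋ {suc p} (λ k → *-congˡ {P⁻¹ r k} (P-column k))) (P⁻¹P≈I r zero)

  Pivot-⊗ : ∀ {p q} {U : Matrix (suc p) (suc p)} {X : Matrix (suc p) q} {j} →
            Invertible U → Pivot (U ⊗ X) j → Pivot X j
  Pivot-⊗ {U = U} {X} {j} U-invertible piv = record
    { Q          = Q ⊗ U
    ; invertible = Invertible-⊗ {A = Q} {U} invertible U-invertible
    ; column     = λ r → trans (⊗-assoc Q U X r j) (column r)
    }
    where open Pivot piv

  pivot : ∀ {p q} (X : Matrix (suc p) q) (j : Fin q) → (∃ λ r → RightInvertible 1# _*_ (X r j)) → Pivot X j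
  pivot X j (zero , X₀ⱼ-invertible) = pivotAtTop X j X₀ⱼ-invertible
  pivot {p} X j (suc r , Xᵣⱼ-invertible) with zero-or-invertible (X zero j)
  ... | inj₂ X₀ⱼ-invertible = pivotAtTop X j X₀ⱼ-invertible
  ... | inj₁ X₀ⱼ≈0 =
    Pivot-⊗ {U = U} U-invertible (pivotAtTop (U ⊗ X) j (RightInvertible-resp Xᵣⱼ≈[UX]₀ⱼ Xᵣⱼ-invertible))
    where
    eᵣ : Matrix 1 p
    eᵣ _ = I r

    -- U adds row suc r to row zero.
    U : Matrix (suc p) (suc p)
    U = blk I eᵣ 0ᴹ I

    U-invertible : Invertible U
    U-invertible = Invertible-blkUpper eᵣ Invertible-I Invertible-I

    Xᵣⱼ≈[UX]₀ⱼ : X (suc r) j ≈ (U ⊗ X) zero j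
    Xᵣⱼ≈[UX]₀ⱼ = begin
      X (suc r) j                                            ≈⟨ +-identityˡ _ ⟨
      0# + X (suc r) j
        ≈⟨ +-cong (trans (*-identityˡ _) X₀ⱼ≈0) (sum-I-* r (λ k → X (suc k) j)) ⟨
      1# * X zero j + sum (λ k → I r k * X (suc k) j)        ∎
      where open SetoidReasoning setoid

  HasRightInverse : ∀ {m p} → Matrix m p → Set (c ⊔ ℓ)
  HasRightInverse {m} {p} R = ∃ λ (Y : Matrix p m) → (R ⊗ Y) ≈ᴹ I

  HasRightInverse-rows : ∀ {m p k} {f : Fin k → Fin m} → Injective _≡_ _≡_ f →
                         (R : Matrix m p) → HasRightInverse R → HasRightInverse (R ∘ f)
  HasRightInverse-rows {f = f} f-inj R (Y , RY≈I) =
    (λ j t → Y j (f t)) , λ s t → trans (RY≈I (f s) (f t)) (I-reindex f-inj s t)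

  HasRightInverse-⊗ : ∀ {m p} {Q : Matrix m m} {R : Matrix m p} →
                      Invertible Q → HasRightInverse R → HasRightInverse (Q ⊗ R)
  HasRightInverse-⊗ {Q = Q} {R} (Q⁻¹ , QQ⁻¹≈I , _) (Y , RY≈I) =
    (Y ⊗ Q⁻¹) , ⊗-rightInverse {A = Q} {Q⁻¹} {R} {Y} QQ⁻¹≈I RY≈I

  HasRightInverse-dropZeroColumn : ∀ {m p} (R : Matrix m (suc p)) → (∀ s → R s zero ≈ 0#) →
                                   HasRightInverse R → HasRightInverse (λ s k → R s (suc k))
  HasRightInverse-dropZeroColumn R R₀≈0 (Y , RY≈I) = (Y ∘ suc) , λ s t → begin
    sum (λ k → R s (suc k) * Y (suc k) t)                  ≈⟨ +-identityˡ _ ⟨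
    0# + sum (λ k → R s (suc k) * Y (suc k) t)             ≈⟨ +-congʳ (trans (*-congʳ (R₀≈0 s)) (zeroˡ _)) ⟨
    R s zero * Y zero t + sum (λ k → R s (suc k) * Y (suc k) t)  ≈⟨ RY≈I s t ⟩
    I s t                                                  ∎
    where open SetoidReasoning setoid

  -- A zero first column is dropped. Otherwise its label lies in S, and pivoting on that column and
  -- deleting the pivot row and column trades one row for that label.
  rows≤∣S∣ : ∀ {n} m p (R : Matrix m p) → HasRightInverse R →
             (b : Fin p → Fin n) → Injective _≡_ _≡_ b → (S : Subset n) →
             (∀ s k → b k ∉ S → R s k ≈ 0#) → m ≤ ∣ S ∣
  rows≤∣S∣ zero    p       R _              b b-inj S R≈0 = z≤n
  rows≤∣S∣ (suc m) zero    R (_ , RY≈I)     b b-inj S R≈0 = contradiction (RY≈I zero zero) 0≉1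
  rows≤∣S∣ (suc m) (suc p) R R-rightInv b b-inj S R≈0
    with ∀⊎∃ (λ s → zero-or-invertible (R s zero))
  ... | inj₁ R₀≈0 =
    rows≤∣S∣ (suc m) p _ (HasRightInverse-dropZeroColumn R R₀≈0 R-rightInv)
             (b ∘ suc) (Finₚ.suc-injective ∘ b-inj) S (λ s k → R≈0 s (suc k))
  ... | inj₂ (s₀ , Rₛ₀-invertible) =
    ℕₚ.<-≤-trans (s≤s m≤∣S-b₀∣) (Subsetₚ.x∈p⇒∣p-x∣<∣p∣ b₀∈S)
    where
    b₀∈S : b zero ∈ S
    b₀∈S with b zero Subsetₚ.∈? S
    ... | yes b₀∈S = b₀∈S
    ... | no  b₀∉S = contradiction Rₛ₀-invertible (0-notRightInvertible (R≈0 s₀ zero b₀∉S))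

    open Pivot (pivot R zero (s₀ , Rₛ₀-invertible))

    minor : Matrix m p
    minor s k = (Q ⊗ R) (suc s) (suc k)

    minor-rightInv : HasRightInverse minor
    minor-rightInv = HasRightInverse-dropZeroColumn ((Q ⊗ R) ∘ suc) (column ∘ suc)
      (HasRightInverse-rows Finₚ.suc-injective (Q ⊗ R)
        (HasRightInverse-⊗ {Q = Q} {R} invertible R-rightInv))

    minor≈0 : ∀ s k → b (suc k) ∉ S ─ ⁅ b zero ⁆ → minor s k ≈ 0#
    minor≈0 s k bₖ∉S-b₀ = ⊗-zeroColumn Q {R} (λ j → R≈0 j (suc k) bₖ∉S) (suc s)
      where
      bₖ∉S : b (suc k) ∉ S
      bₖ∉S bₖ∈S =
        bₖ∉S-b₀ (Subsetₚ.x∈p∧x≢y⇒x∈p-y bₖ∈S (λ bₖ≡b₀ → Finₚ.0≢1+n (b-inj (≡.sym bₖ≡b₀))))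

    m≤∣S-b₀∣ : m ≤ ∣ S ─ ⁅ b zero ⁆ ∣
    m≤∣S-b₀∣ = rows≤∣S∣ m p minor minor-rightInv (b ∘ suc) (Finₚ.suc-injective ∘ b-inj) _ minor≈0

  -- Transversals and certificates

  LastRowsVanish : ∀ {p q} → ℕ → Matrix p q → Set ℓ
  LastRowsVanish {p} m X = ∀ r → p ∸ m ≤ toℕ r → ∀ j → X r j ≈ 0#

  LastRowsVanish-resp : ∀ {p q m} {X Y : Matrix p q} →
                        X ≈ᴹ Y → LastRowsVanish m X → LastRowsVanish m Y
  LastRowsVanish-resp X≈Y X≈0 r r≥ j = trans (sym (X≈Y r j)) (X≈0 r r≥ j)

  LastRowsVanish⇒bottomRows≈0 : ∀ {d m q} {X : Matrix (d ℕ.+ m) q} →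
                                LastRowsVanish m X → bottomRows {d} X ≈ᴹ 0ᴹ
  LastRowsVanish⇒bottomRows≈0 {d} {m} X≈0 s =
    X≈0 (d ↑ʳ s) (≡.subst (_≤ toℕ (d ↑ʳ s)) (≡.sym (ℕₚ.m+n∸n≡m d m)) (≤-toℕ-↑ʳ d s))

  LastRowsVanish-topRows : ∀ {d m k q} {X : Matrix (d ℕ.+ m) q} →
                           LastRowsVanish k (topRows {d} X) → bottomRows {d} X ≈ᴹ 0ᴹ →
                           LastRowsVanish (k ℕ.+ m) X
  LastRowsVanish-topRows {d} {m} {k} {X = X} top≈0 bottom≈0 = ↑-elim d
    (λ a r≥ → top≈0 a (≡.subst₂ _≤_ [d+m]∸[k+m]≡d∸k (Finₚ.toℕ-↑ˡ a m) r≥))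
    (λ s _ → bottom≈0 s)
    where
    [d+m]∸[k+m]≡d∸k : (d ℕ.+ m) ∸ (k ℕ.+ m) ≡ d ∸ k
    [d+m]∸[k+m]≡d∸k = ≡.trans (≡.cong₂ _∸_ (ℕₚ.+-comm d m) (ℕₚ.+-comm k m)) (ℕₚ.[m+n]∸[m+o]≡n∸o m d k)

  LastRowsVanish-bottomRows : ∀ {d m k q} {X : Matrix (d ℕ.+ m) q} → k ≤ m →
                              LastRowsVanish k (bottomRows {d} X) → LastRowsVanish k X
  LastRowsVanish-bottomRows {d} {m} {k} k≤m bottom≈0 = ↑-elim d
    (λ a r≥ → contradiction
      (ℕₚ.≤-trans (ℕₚ.m≤m+n d (m ∸ k)) (≡.subst (_≤ toℕ (a ↑ˡ m)) [d+m]∸k≡d+[m∸k] r≥))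
      (ℕₚ.<⇒≱ (toℕ-↑ˡ< m a)))
    (λ s r≥ → bottom≈0 s (ℕₚ.+-cancelˡ-≤ d _ _ (≡.subst₂ _≤_ [d+m]∸k≡d+[m∸k] (Finₚ.toℕ-↑ʳ d s) r≥)))
    where
    [d+m]∸k≡d+[m∸k] : (d ℕ.+ m) ∸ k ≡ d ℕ.+ (m ∸ k)
    [d+m]∸k≡d+[m∸k] = ℕₚ.+-∸-assoc d k≤m

  module _ {n : ℕ} {qs : Fin n → ℕ} where

    ColumnBlocks : ℕ → Set c
    ColumnBlocks p = (i : Fin n) → Matrix p (qs i)

    Column : Set
    Column = Σ (Fin n) (λ i → Fin (qs i))

    submatrix : ∀ {p k} → ColumnBlocks p → (Fin k → Column) → Matrix p k
    submatrix M cols r k = M (proj₁ (cols k)) r (proj₂ (cols k))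

    _·_ : ∀ {p} → Matrix p p → ColumnBlocks p → ColumnBlocks p
    (Q · M) i = Q ⊗ M i

    topPart : ∀ {d m} → ColumnBlocks (d ℕ.+ m) → ColumnBlocks d
    topPart {d} M i = topRows {d} (M i)

    bottomPart : ∀ {d m} → ColumnBlocks (d ℕ.+ m) → ColumnBlocks m
    bottomPart {d} M i = bottomRows {d} (M i)

    record Transversal {p} (M : ColumnBlocks p) (A : Subset n) : Set (c ⊔ ℓ) where
      field
        columns    : Fin p → Column
        distinct   : Injective _≡_ _≡_ (proj₁ ∘ columns)
        active     : ∀ k → proj₁ (columns k) ∈ A
        invertible : Invertible (submatrix M columns)

    record Certificate {p} (M : ColumnBlocks p) (A : Subset n) : Set (c ⊔ ℓ) where
      field
        Q          : Matrix p p
        invertible : Invertible Q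
        m          : ℕ
        1≤m        : 1 ≤ m
        m≤p        : m ≤ p
        S          : Subset n
        ∣S∣<m      : ∣ S ∣ < m
        vanishes   : ∀ i → i ∈ A → i ∉ S → LastRowsVanish m (Q ⊗ M i)

    Outcome : ∀ {p} → ColumnBlocks p → Subset n → Set (c ⊔ ℓ)
    Outcome M A = Transversal M A ⊎ Certificate M A

    Transversal⇒¬Certificate : ∀ {p} {M : ColumnBlocks p} {A} → Transversal M A → ¬ Certificate M A
    Transversal⇒¬Certificate {p} {M} t c =
      ℕₚ.<⇒≱ ∣S∣<m (rows≤∣S∣ m p R R-rightInv (proj₁ ∘ columns) distinct S R≈0)
      where
      open Transversal t
      open Certificate c renaming (invertible to Q-invertible)

      R : Matrix m p
      R = (Q ⊗ submatrix M columns) ∘ lastRows m≤p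

      R-rightInv : HasRightInverse R
      R-rightInv with Invertible-⊗ Q-invertible invertible
      ... | Y , QNY≈I , _ = HasRightInverse-rows (lastRows-injective m≤p) _ (Y , QNY≈I)

      R≈0 : ∀ s k → proj₁ (columns k) ∉ S → R s k ≈ 0#
      R≈0 s k bₖ∉S = vanishes _ (active k) bₖ∉S (lastRows m≤p s)
        (≡.subst (p ∸ m ≤_) (≡.sym (toℕ-lastRows m≤p s)) (ℕₚ.m≤m+n (p ∸ m) (toℕ s))) (proj₂ (columns k))

    Outcome-· : ∀ {p} {Q : Matrix p p} {M : ColumnBlocks p} {A} →
                Invertible Q → Outcome (Q · M) A → Outcome M A
    Outcome-· {Q = Q} {M} Q-invertible (inj₁ t) = inj₁ record
      { columns    = columns
      ; distinct   = distinct
      ; active     = active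
      ; invertible = Invertible-cancelˡ {Q = Q} {submatrix M columns} Q-invertible invertible
      }
      where open Transversal t
    Outcome-· {p} {Q} {M} {A} Q-invertible (inj₂ c) = inj₂ record
      { Q          = Q′ ⊗ Q
      ; invertible = Invertible-⊗ invertible Q-invertible
      ; m = m ; 1≤m = 1≤m ; m≤p = m≤p ; S = S ; ∣S∣<m = ∣S∣<m
      ; vanishes   = λ i i∈A i∉S →
          LastRowsVanish-resp {m = m} (≈ᴹ.sym (⊗-assoc Q′ Q (M i))) (vanishes i i∈A i∉S)
      }
      where open Certificate c renaming (Q to Q′)

    Certificate-zero : ∀ {p} {M : ColumnBlocks (suc p)} {A} → (∀ i → i ∈ A → M i ≈ᴹ 0ᴹ) → Certificate M A
    Certificate-zero {M = M} M≈0 = record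
      { Q = I ; invertible = Invertible-I ; m = 1 ; 1≤m = ℕₚ.≤-refl ; m≤p = s≤s z≤n ; S = ⊥
      ; ∣S∣<m    = ≡.subst (_< 1) (≡.sym (Subsetₚ.∣⊥∣≡0 n)) (s≤s z≤n)
      ; vanishes = λ i i∈A _ r _ j → trans (⊗-identityˡ (M i) r j) (M≈0 i i∈A r j)
      }

    Transversal-∷ : ∀ {p} {M : ColumnBlocks (suc p)} {A i₀ j₀} → i₀ ∈ A → (∀ r → M i₀ r j₀ ≈ I r zero) →
                    Transversal (bottomPart {1} M) (A ∩ ∁ ⁅ i₀ ⁆) → Transversal M A
    Transversal-∷ {p} {M} {A} {i₀} {j₀} i₀∈A M₀≈e₀ t = record
      { columns    = (i₀ , j₀) Vector.∷ columns
      ; distinct   = distinct′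
      ; active     = λ { zero → i₀∈A ; (suc k) → proj₁ (Subsetₚ.x∈p∩q⁻ _ _ (active k)) }
      ; invertible = Invertible-resp (≈ᴹ.sym N≈blk) (Invertible-blkUpper firstRow Invertible-I invertible)
      }
      where
      open Transversal t

      ≢i₀ : ∀ k → proj₁ (columns k) ≢ i₀
      ≢i₀ k eq = Subsetₚ.x∈∁p⇒x∉p (proj₂ (Subsetₚ.x∈p∩q⁻ _ _ (active k)))
                   (≡.subst (_∈ ⁅ i₀ ⁆) (≡.sym eq) (Subsetₚ.x∈⁅x⁆ i₀))

      distinct′ : Injective _≡_ _≡_ (proj₁ ∘ ((i₀ , j₀) Vector.∷ columns))
      distinct′ {zero}  {zero}  _  = ≡.refl
      distinct′ {zero}  {suc l} eq = contradiction (≡.sym eq) (≢i₀ l)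
      distinct′ {suc k} {zero}  eq = contradiction eq (≢i₀ k)
      distinct′ {suc k} {suc l} eq = ≡.cong suc (distinct eq)

      firstRow : Matrix 1 p
      firstRow _ k = M (proj₁ (columns k)) zero (proj₂ (columns k))

      N≈blk : submatrix M ((i₀ , j₀) Vector.∷ columns) ≈ᴹ blk I firstRow 0ᴹ (submatrix (bottomPart M) columns)
      N≈blk zero    zero    = M₀≈e₀ zero
      N≈blk zero    (suc k) = refl
      N≈blk (suc r) zero    = M₀≈e₀ (suc r)
      N≈blk (suc r) (suc k) = refl

    module _ {d m : ℕ} {M : ColumnBlocks (d ℕ.+ m)} {A T : Subset n}
             (bottom≈0 : ∀ i → i ∈ A → i ∉ T → bottomRows {d} (M i) ≈ᴹ 0ᴹ) where

      Transversal-++ : Transversal (topPart {d} M) (A ∩ ∁ T) → Transversal (bottomPart {d} M) (A ∩ T) →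
                       Transversal M A
      Transversal-++ t↑ t↓ = record
        { columns    = cols↑ ++ cols↓
        ; distinct   = ∘-++-injective proj₁ distinct↑ distinct↓ disjoint
        ; active     = λ k → [_,_] {C = λ u → proj₁ ([ cols↑ , cols↓ ]′ u) ∈ A}
                               (λ a → proj₁ (Subsetₚ.x∈p∩q⁻ A _ (active↑ a)))
                               (λ s → proj₁ (Subsetₚ.x∈p∩q⁻ A T (active↓ s))) (splitAt d k)
        ; invertible = Invertible-resp (≈ᴹ.sym N≈blk) (Invertible-blkUpper B invertible↑ invertible↓)
        }
        where
        open Transversal t↑ renaming (columns to cols↑; distinct to distinct↑; active to active↑;
                                      invertible to invertible↑)
        open Transversal t↓ renaming (columns to cols↓; distinct to distinct↓; active to active↓;
                                      invertible to invertible↓)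

        ∉T : ∀ a → proj₁ (cols↑ a) ∉ T
        ∉T a = Subsetₚ.x∈∁p⇒x∉p (proj₂ (Subsetₚ.x∈p∩q⁻ A _ (active↑ a)))

        disjoint : ∀ a s → proj₁ (cols↑ a) ≢ proj₁ (cols↓ s)
        disjoint a s eq = ∉T a (≡.subst (_∈ T) (≡.sym eq) (proj₂ (Subsetₚ.x∈p∩q⁻ A T (active↓ s))))

        N : Matrix (d ℕ.+ m) (d ℕ.+ m)
        N = submatrix M (cols↑ ++ cols↓)

        B : Matrix d m
        B a s = M (proj₁ (cols↓ s)) (a ↑ˡ m) (proj₂ (cols↓ s))

        column-++ˡ : ∀ r a → N r (a ↑ˡ m) ≈ submatrix M cols↑ r a
        column-++ˡ r a = reflexive (≡.cong (λ col → M (proj₁ col) r (proj₂ col)) (lookup-++ˡ cols↑ cols↓ a))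

        column-++ʳ : ∀ r s → N r (d ↑ʳ s) ≈ submatrix M cols↓ r s
        column-++ʳ r s = reflexive (≡.cong (λ col → M (proj₁ col) r (proj₂ col)) (lookup-++ʳ cols↑ cols↓ s))

        N≈blk : N ≈ᴹ blk (submatrix (topPart {d} M) cols↑) B 0ᴹ (submatrix (bottomPart {d} M) cols↓)
        N≈blk = ≈ᴹ-blk _ _ _ _
          (λ a b → column-++ˡ (a ↑ˡ m) b)
          (λ a s → column-++ʳ (a ↑ˡ m) s)
          (λ s b → trans (column-++ˡ (d ↑ʳ s) b)
                         (bottom≈0 _ (proj₁ (Subsetₚ.x∈p∩q⁻ A _ (active↑ b))) (∉T b) s (proj₂ (cols↑ b))))
          (λ s t → column-++ʳ (d ↑ʳ s) t)

      Certificate-top : ∣ T ∣ ≤ m → Certificate (topPart {d} M) (A ∩ ∁ T) → Certificate M A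
      Certificate-top ∣T∣≤m c = record
        { Q          = diag Q↑ I
        ; invertible = Invertible-diag invertible↑ Invertible-I
        ; m          = m↑ ℕ.+ m
        ; 1≤m        = ℕₚ.≤-trans 1≤m↑ (ℕₚ.m≤m+n m↑ m)
        ; m≤p        = ℕₚ.+-monoˡ-≤ m m↑≤d
        ; S          = S↑ ∪ T
        ; ∣S∣<m      = ℕₚ.≤-<-trans (∣p∪q∣≤∣p∣+∣q∣ S↑ T) (ℕₚ.+-mono-<-≤ ∣S↑∣<m↑ ∣T∣≤m)
        ; vanishes   = vanishes′
        }
        where
        open Certificate c renaming (Q to Q↑; invertible to invertible↑; m to m↑; 1≤m to 1≤m↑; m≤p to m↑≤d;
                                     S to S↑; ∣S∣<m to ∣S↑∣<m↑; vanishes to vanishes↑)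

        vanishes′ : ∀ i → i ∈ A → i ∉ S↑ ∪ T → LastRowsVanish (m↑ ℕ.+ m) (diag Q↑ I ⊗ M i)
        vanishes′ i i∈A i∉S↑∪T = LastRowsVanish-topRows {d = d} {k = m↑}
          (LastRowsVanish-resp {m = m↑} (≈ᴹ.sym (topRows-diag-⊗ Q↑ I (M i)))
            (vanishes↑ i (Subsetₚ.x∈p∩q⁺ (i∈A , Subsetₚ.x∉p⇒x∈∁p i∉T)) (i∉S↑∪T ∘ Subsetₚ.x∈p∪q⁺ ∘ inj₁)))
          (≈ᴹ.trans (bottomRows-diag-⊗ Q↑ I (M i)) (≈ᴹ.trans (⊗-identityˡ _) (bottom≈0 i i∈A i∉T)))
          where
          i∉T : i ∉ T
          i∉T = i∉S↑∪T ∘ Subsetₚ.x∈p∪q⁺ ∘ inj₂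

      Certificate-bottom : Certificate (bottomPart {d} M) (A ∩ T) → Certificate M A
      Certificate-bottom c = record
        { Q          = diag I Q↓
        ; invertible = Invertible-diag Invertible-I invertible↓
        ; m          = m↓
        ; 1≤m        = 1≤m↓
        ; m≤p        = ℕₚ.≤-trans m↓≤m (ℕₚ.m≤n+m m d)
        ; S          = S↓
        ; ∣S∣<m      = ∣S↓∣<m↓
        ; vanishes   = λ i i∈A i∉S↓ → LastRowsVanish-bottomRows {d = d} m↓≤m
            (LastRowsVanish-resp {m = m↓} (≈ᴹ.sym (bottomRows-diag-⊗ I Q↓ (M i))) (bottomVanishes i i∈A i∉S↓))
        }
        where
        open Certificate c renaming (Q to Q↓; invertible to invertible↓; m to m↓; 1≤m to 1≤m↓; m≤p to m↓≤m;
                                     S to S↓; ∣S∣<m to ∣S↓∣<m↓; vanishes to vanishes↓)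

        bottomVanishes : ∀ i → i ∈ A → i ∉ S↓ → LastRowsVanish m↓ (Q↓ ⊗ bottomRows {d} (M i))
        bottomVanishes i i∈A i∉S↓ with i Subsetₚ.∈? T
        ... | yes i∈T = vanishes↓ i (Subsetₚ.x∈p∩q⁺ (i∈A , i∈T)) i∉S↓
        ... | no  i∉T = λ s _ j → ⊗-zeroColumn Q↓ {bottomRows {d} (M i)} (λ t → bottom≈0 i i∈A i∉T t j) s

    Dichotomy : ℕ → Set (c ⊔ ℓ)
    Dichotomy p = (M : ColumnBlocks p) (A : Subset n) → Outcome M A

    split : ∀ {p} d m → d ℕ.+ m ≡ p → (∀ {k} → k < p → Dichotomy k) → 1 ≤ d → 1 ≤ m →
            (M : ColumnBlocks p) (A T : Subset n) → ∣ T ∣ ≤ m →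
            (∀ i → i ∈ A → i ∉ T → LastRowsVanish m (M i)) → Outcome M A
    split d m ≡.refl rec 1≤d 1≤m M A T ∣T∣≤m vanishes =
      combine (rec (ℕₚ.m<m+n d 1≤m) (topPart {d} M) (A ∩ ∁ T))
              (rec (ℕₚ.m<n+m m 1≤d) (bottomPart {d} M) (A ∩ T))
      where
      bottom≈0 : ∀ i → i ∈ A → i ∉ T → bottomRows {d} (M i) ≈ᴹ 0ᴹ
      bottom≈0 i i∈A i∉T = LastRowsVanish⇒bottomRows≈0 (vanishes i i∈A i∉T)

      combine : Outcome (topPart {d} M) (A ∩ ∁ T) → Outcome (bottomPart {d} M) (A ∩ T) → Outcome M A
      combine (inj₂ c↑) _         = inj₂ (Certificate-top bottom≈0 ∣T∣≤m c↑)
      combine (inj₁ _)  (inj₂ c↓) = inj₂ (Certificate-bottom bottom≈0 c↓)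
      combine (inj₁ t↑) (inj₁ t↓) = inj₁ (Transversal-++ bottom≈0 t↑ t↓)

    eliminate : ∀ {p} → (∀ {k} → k < suc p → Dichotomy k) → (M : ColumnBlocks (suc p)) (A : Subset n) →
                ∀ {i₀ j₀} → i₀ ∈ A → (∀ r → M i₀ r j₀ ≈ I r zero) → Outcome M A
    eliminate {p} rec M A {i₀} i₀∈A M₀≈e₀ with rec ℕₚ.≤-refl (bottomPart {1} M) (A ∩ ∁ ⁅ i₀ ⁆)
    ... | inj₁ t = inj₁ (Transversal-∷ i₀∈A M₀≈e₀ t)
    ... | inj₂ c = Outcome-· {Q = Q₁} (Invertible-diag Invertible-I invertible)
                     (split (suc p ∸ m) m (ℕₚ.m∸n+n≡m (ℕₚ.m≤n⇒m≤1+n m≤p)) rec (ℕₚ.m<n⇒0<n∸m (s≤s m≤p)) 1≤m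
                            (Q₁ · M) A T ∣T∣≤m vanishes′)
      where
      open Certificate c

      Q₁ : Matrix (suc p) (suc p)
      Q₁ = diag (I {1}) Q

      T : Subset n
      T = S ∪ ⁅ i₀ ⁆

      ∣T∣≤m : ∣ T ∣ ≤ m
      ∣T∣≤m = begin
        ∣ S ∪ ⁅ i₀ ⁆ ∣        ≤⟨ ∣p∪q∣≤∣p∣+∣q∣ S ⁅ i₀ ⁆ ⟩
        ∣ S ∣ ℕ.+ ∣ ⁅ i₀ ⁆ ∣  ≡⟨ ≡.cong (∣ S ∣ ℕ.+_) (Subsetₚ.∣⁅x⁆∣≡1 i₀) ⟩
        ∣ S ∣ ℕ.+ 1           ≡⟨ ℕₚ.+-comm ∣ S ∣ 1 ⟩
        suc ∣ S ∣             ≤⟨ ∣S∣<m ⟩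
        m                     ∎
        where open ℕₚ.≤-Reasoning

      vanishes′ : ∀ i → i ∈ A → i ∉ T → LastRowsVanish m (Q₁ ⊗ M i)
      vanishes′ i i∈A i∉T = LastRowsVanish-bottomRows {d = 1} m≤p
        (LastRowsVanish-resp {m = m} (≈ᴹ.sym (bottomRows-diag-⊗ I Q (M i)))
          (vanishes i (Subsetₚ.x∈p∩q⁺ (i∈A , Subsetₚ.x∉p⇒x∈∁p (i∉T ∘ Subsetₚ.x∈p∪q⁺ ∘ inj₂)))
                      (i∉T ∘ Subsetₚ.x∈p∪q⁺ ∘ inj₁)))

    dichotomy : ∀ p → Dichotomy p
    dichotomy = <-rec Dichotomy step
      where
      step : ∀ p → (∀ {k} → k < p → Dichotomy k) → Dichotomy p
      step zero _ M A = inj₁ record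
        { columns = λ () ; distinct = λ { {()} } ; active = λ () ; invertible = (λ ()) , (λ ()) , (λ ()) }
      step (suc p) rec M A with ∀⊎∃ activeBlock
        where
        activeBlock : ∀ i → (i ∈ A → M i ≈ᴹ 0ᴹ) ⊎ (i ∈ A × ∃₂ λ r j → RightInvertible 1# _*_ (M i r j))
        activeBlock i with i Subsetₚ.∈? A
        ... | no  i∉A = inj₁ (λ i∈A → contradiction i∈A i∉A)
        ... | yes i∈A = Sum.map (λ M≈0 _ → M≈0) (i∈A ,_) (zero-or-unitEntry (M i))
      ... | inj₁ M≈0 = inj₂ (Certificate-zero M≈0)
      ... | inj₂ (i₀ , i₀∈A , r , j₀ , unit) =
        Outcome-· {Q = Q} invertible (eliminate rec (Q · M) A i₀∈A column)
        where open Pivot (pivot (M i₀) j₀ (r , unit))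

mainTheorem2 : ∀ {c ℓ} (K : Field c ℓ) (p n : ℕ) (qs : Fin n → ℕ)
    (M : (i : Fin n) → Matrices.Matrix K p (qs i)) →
    let open Field K
        open Matrices K
    in (∀ (b : Fin p → Fin n) → (∀ k l → b k ≡ b l → k ≡ l) →
          (col : (k : Fin p) → Fin (qs (b k))) →
          ¬ Invertible (λ r k → M (b k) r (col k)))
       ⇔
       (Σ (Matrix p p) λ Q → Invertible Q ×
         Σ ℕ λ m → 1 ≤ m × m ≤ p ×
           Σ (Subset n) λ S → ∣ S ∣ < m ×
             (∀ i → i ∉ S → ∀ (r : Fin p) → p ∸ m ≤ toℕ r →
                ∀ j → (Q ⊗ M i) r j ≈ 0#))
mainTheorem2 K p n qs M = mk⇔
  (λ noTransversal → [ (λ t → let open Transversal t in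
                          contradiction invertible
                            (noTransversal (proj₁ ∘ columns) (λ _ _ → distinct) (proj₂ ∘ columns)))
                     , (λ c → let open Certificate c in
                          Q , invertible , m , 1≤m , m≤p , S , ∣S∣<m , λ i → vanishes i Subsetₚ.∈⊤)
                     ]′ (dichotomy K p M ⊤))
  (λ (Q , Q-invertible , m , 1≤m , m≤p , S , ∣S∣<m , vanishes) b b-injective col N-invertible →
     Transversal⇒¬Certificate K
       (record { columns = λ k → b k , col k ; distinct = b-injective _ _ ; active = λ _ → Subsetₚ.∈⊤
               ; invertible = N-invertible })
       (record { Q = Q ; invertible = Q-invertible ; m = m ; 1≤m = 1≤m ; m≤p = m≤p ; S = S ; ∣S∣<m = ∣S∣<m
               ; vanishes = λ i _ → vanishes i }))
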